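{- Let $f:2^{[n]}\to\mathbb{R}_{\ge0}$ be either a coverage function or a sum of matroid rank functions of matroids on ground set $[n]$. For $0\le i\le n$ let $f_i=\sum_{S\subseteq[n],\,|S|=i}f(S)$. Then the sequence $f_0,f_1,\dots,f_n$ is ultra log-concave, i.e. for every $1<k<n$, $$\left(\frac{f_k}{\binom{n+1}{k}}\right)^2\ \ge\ \frac{f_{k-1}}{\binom{n+1}{k-1}}\cdot\frac{f_{k+1}}{\binom{n+1}{k+1}}.$$
   Context: A function $f:2^{[n]}\to\mathbb{R}_{\ge0}$ is a coverage function if there are a finite set $U$, subsets $A_1,\dots,A_n\subseteq U$ and a nonnegative measure $w$ on $U$ with $f(T)=w(\bigcup_{i\in T}A_i)$ for all $T\subseteq[n]$. The paper's notion of ultra log-concavity of a sequence $c_0,\dots,c_n$ is the displayed inequality with binomial coefficients $\binom{n+1}{\cdot}$ for $1<k<n$.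
   Formalization: The function f and, for coverage functions, the nonnegative measure w take rational values rather than real ones. -}

module Defs where

open import Data.Bool using (Bool; true; false; if_then_else_; _∨_)
open import Data.Nat as ℕ using (ℕ; zero; suc; z≤n; s≤s)
open import Data.Nat.Properties as ℕP using ()
open import Data.Nat.Combinatorics using (_C_; nCk≡nC[n∸k]; nCn≡1; nCk+nC[k+1]≡[n+1]C[k+1])
open import Data.Fin using (Fin; zero; suc)
open import Data.Fin.Subset using (Subset; ∣_∣; _⊆_; _∪_; _∩_; ⊥; _∈_)
open import Data.Vec using (Vec; []; _∷_; lookup)
open import Data.List using (List; []; _∷_; map; _++_; filter; foldr)
open import Data.Integer using (+_)
open import Data.Rational using (ℚ; 0ℚ; _+_; _*_; _/_; _≤_)
open import Data.Product using (Σ; ∃; _×_; _,_)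
open import Relation.Binary.PropositionalEquality using (_≡_; refl; sym; trans; subst)
open import Relation.Nullary using (yes; no)

allSubsets : (n : ℕ) → List (Subset n)
allSubsets zero    = [] ∷ []
allSubsets (suc n) = map (false ∷_) (allSubsets n) ++ map (true ∷_) (allSubsets n)

sumℚ : List ℚ → ℚ
sumℚ = foldr _+_ 0ℚ

Σℚ : (m : ℕ) → (Fin m → ℚ) → ℚ
Σℚ zero    g = 0ℚ
Σℚ (suc m) g = g zero + Σℚ m (λ i → g (suc i))

levelSum : (n : ℕ) → (Subset n → ℚ) → ℕ → ℚ
levelSum n f i = sumℚ (map f (filter (λ S → ∣ S ∣ ℕ.≟ i) (allSubsets n)))

bigUnion : {n m : ℕ} → (Fin n → Subset m) → Subset n → Subset m
bigUnion {zero}  A []           = ⊥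
bigUnion {suc n} A (false ∷ T)  = bigUnion (λ i → A (suc i)) T
bigUnion {suc n} A (true ∷ T)   = A zero ∪ bigUnion (λ i → A (suc i)) T

measure : {m : ℕ} → (Fin m → ℚ) → Subset m → ℚ
measure {m} w X = Σℚ m (λ u → if lookup X u then w u else 0ℚ)

IsCoverage : {n : ℕ} → (Subset n → ℚ) → Set
IsCoverage {n} f =
  Σ ℕ λ m → Σ (Fin n → Subset m) λ A → Σ (Fin m → ℚ) λ w →
    ((u : Fin m) → 0ℚ ≤ w u) × ((T : Subset n) → f T ≡ measure w (bigUnion A T))

record IsMatroidRank {n : ℕ} (r : Subset n → ℕ) : Set where
  field
    bounded    : ∀ S → r S ℕ.≤ ∣ S ∣
    monotone   : ∀ {S T} → S ⊆ T → r S ℕ.≤ r T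
    submodular : ∀ S T → r (S ∪ T) ℕ.+ r (S ∩ T) ℕ.≤ r S ℕ.+ r T

IsSumOfMatroidRanks : {n : ℕ} → (Subset n → ℚ) → Set
IsSumOfMatroidRanks {n} f =
  Σ (List (Subset n → ℕ)) λ rs →
    (∀ {r} → r Data.List.Membership.Propositional.∈ rs → IsMatroidRank r) ×
    ((T : Subset n) → f T ≡ + (foldr (λ r acc → r T ℕ.+ acc) 0 rs) / 1)
  where import Data.List.Membership.Propositional

nCk>0 : ∀ {n k} → k ℕ.≤ n → 0 ℕ.< n C k
nCk>0 {n} {zero} z≤n =
  subst (0 ℕ.<_) (sym (trans (nCk≡nC[n∸k] {0} {n} z≤n) (nCn≡1 n))) (s≤s z≤n)
nCk>0 {suc n} {suc k} (s≤s k≤n) =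
  subst (0 ℕ.<_) (nCk+nC[k+1]≡[n+1]C[k+1] n k)
        (ℕP.<-≤-trans (nCk>0 k≤n) (ℕP.m≤m+n (n C k) (n C suc k)))

normalised : (c : ℕ → ℚ) (N k : ℕ) → k ℕ.≤ N → ℚ
normalised c N k k≤N = c k * ((+ 1 / (N C k)) {{ℕ.>-nonZero (nCk>0 k≤N)}})

UltraLogConcave : (n : ℕ) → (ℕ → ℚ) → Set
UltraLogConcave n c =
  (k : ℕ) → (1<k : 1 ℕ.< k) → (k<n : k ℕ.< n) →
    normalised c (suc n) (ℕ.pred k) (ℕP.≤-trans ℕP.pred[n]≤n (ℕP.m≤n⇒m≤1+n (ℕP.<⇒≤ k<n)))
      * normalised c (suc n) (suc k) (ℕP.m≤n⇒m≤1+n k<n)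
    ≤ normalised c (suc n) k (ℕP.m≤n⇒m≤1+n (ℕP.<⇒≤ k<n))
      * normalised c (suc n) k (ℕP.m≤n⇒m≤1+n (ℕP.<⇒≤ k<n))

-- Coverage functions and sums of matroid rank functions are nonnegative, monotone and submodular,
-- and nothing else is used. For such f, summing first differences over pairs S ⊂ T with
-- |T| = |S| + 1 and second differences over |S| = j, a ≠ b ∉ S, gives two nonnegative linear
-- combinations of the level sums f_j, f_{j+1}, f_{j+2} (by induction on n, splitting off the first
-- element). Twice the first plus the second says, with k = j + 1 and m = n − k,
--   (m+1)(m+2) f_{k−1} + k(k+1) f_{k+1} ≤ 2k(m+1) f_k,
-- and AM–GM turns this into (k+1)(m+2) f_{k−1} f_{k+1} ≤ k(m+1) f_k², which is ultra
-- log-concavity at k once the binomial coefficients are cleared.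

{-# OPTIONS --safe #-}
module Submission where

open import Defs
open import Data.Nat using (ℕ)
open import Data.Fin.Subset using (Subset)
open import Data.Rational using (ℚ)
open import Data.Sum using (_⊎_)

open import Data.Bool using (Bool; true; false; if_then_else_; _∨_; _∧_)
open import Data.Fin using (Fin; zero; suc)
open import Data.Fin.Subset using (_⊆_; _∪_; _∩_; _∈_; ∣_∣)
open import Data.Fin.Subset.Properties
  using (∉⊥; x∈p∪q⁺; x∈p∪q⁻; x∈p∩q⁺; p∩q⊆p; p∩q⊆q; q⊆p∪q; ⊆-antisym; ⊆-refl; drop-∷-⊆; s⊆s; out⊆)
open import Data.Integer as ℤ using ()
import Data.Integer.Properties as ℤP
open import Data.List using (List; []; _∷_; map; _++_; filter; foldr)
open import Data.List.Properties using (map-++; map-∘)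
import Data.List.Relation.Unary.Any as Any
open import Data.List.Membership.Propositional using () renaming (_∈_ to _∈ₗ_)
open import Data.Nat as ℕ using (zero; suc; z≤n; s≤s)
import Data.Nat.Properties as ℕP
import Data.Nat.Tactic.RingSolver as ℕ-Solver
open import Data.Nat.Combinatorics using (_C_; nC1≡n; nCk+nC[k+1]≡[n+1]C[k+1])
import Data.Nat.Coprimality as Coprime
open import Data.Product using (∃; _×_; _,_)
open import Data.Rational as ℚ using (0ℚ; 1ℚ; _+_; _*_; _-_; -_; _≤_; _<_; _/_; mkℚ)
import Data.Rational.Properties as ℚP
open import Algebra.Bundles using (CommutativeMonoid)
open import Algebra.Properties.CommutativeSemigroup (CommutativeMonoid.commutativeSemigroup ℚP.+-0-commutativeMonoid)
  using (interchange)
open import Data.Sum as Sum using (inj₁; inj₂; [_,_]′)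
open import Data.Vec using ([]; _∷_; here; there)
open import Function using (_∘_; id)
open import Level using (0ℓ)
open import Relation.Binary.PropositionalEquality
  using (_≡_; _≗_; refl; sym; trans; cong; cong₂; subst; subst₂; module ≡-Reasoning)
open import Relation.Nullary using (does; contradiction)
open import Relation.Nullary.Decidable using (dec⇒maybe)
open import Relation.Unary using (Pred; Decidable)
open import Tactic.RingSolver using (solve-∀)
open import Tactic.RingSolver.Core.AlmostCommutativeRing using (AlmostCommutativeRing; fromCommutativeRing)

ℚ-ring : AlmostCommutativeRing 0ℓ 0ℓ
ℚ-ring = fromCommutativeRing ℚP.+-*-commutativeRing (dec⇒maybe ∘ (0ℚ ℚP.≟_))

p≤q⇒0≤q-p : ∀ {p q} → p ≤ q → 0ℚ ≤ q - p
p≤q⇒0≤q-p {p} {q} p≤q = subst (_≤ q - p) (ℚP.+-inverseʳ p) (ℚP.+-monoˡ-≤ (- p) p≤q)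

0≤q-p⇒p≤q : ∀ {p q} → 0ℚ ≤ q - p → p ≤ q
0≤q-p⇒p≤q {p} {q} 0≤q-p = subst₂ _≤_ (ℚP.+-identityˡ p) (cancel p q) (ℚP.+-monoˡ-≤ p 0≤q-p)
  where
  cancel : ∀ p q → q - p + p ≡ q
  cancel = solve-∀ ℚ-ring

0≤p+q : ∀ {p q} → 0ℚ ≤ p → 0ℚ ≤ q → 0ℚ ≤ p + q
0≤p+q = ℚP.+-mono-≤

0≤p*q : ∀ {p q} → 0ℚ ≤ p → 0ℚ ≤ q → 0ℚ ≤ p * q
0≤p*q {p} {q} 0≤p 0≤q =
  ℚP.nonNegative⁻¹ (p * q) {{ℚP.nonNeg*nonNeg⇒nonNeg p {{ℚ.nonNegative 0≤p}} q {{ℚ.nonNegative 0≤q}}}}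

0<p*q : ∀ {p q} → 0ℚ < p → 0ℚ < q → 0ℚ < p * q
0<p*q {p} {q} 0<p 0<q =
  ℚP.positive⁻¹ (p * q) {{ℚP.pos*pos⇒pos p {{ℚ.positive 0<p}} q {{ℚ.positive 0<q}}}}

0≤p*p : ∀ p → 0ℚ ≤ p * p
0≤p*p p = [ (λ 0≤p → 0≤p*q 0≤p 0≤p) , (λ p≤0 → subst (0ℚ ≤_) (neg*neg p) (0≤[-p]² p≤0)) ]′
            (ℚP.≤-total 0ℚ p)
  where
  0≤[-p]² : p ≤ 0ℚ → 0ℚ ≤ - p * - p
  0≤[-p]² p≤0 = 0≤p*q (ℚP.neg-antimono-≤ p≤0) (ℚP.neg-antimono-≤ p≤0)
  neg*neg : ∀ p → - p * - p ≡ p * p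
  neg*neg = solve-∀ ℚ-ring

0≤2 : 0ℚ ≤ 1ℚ + 1ℚ
0≤2 = ℚP.nonNegative⁻¹ (1ℚ + 1ℚ)

0≤p⇒0<p+1 : ∀ {p} → 0ℚ ≤ p → 0ℚ < p + 1ℚ
0≤p⇒0<p+1 0≤p = ℚP.+-mono-≤-< 0≤p (ℚP.positive⁻¹ 1ℚ)

*-mono-≤-nonNeg : ∀ {p q r s} → 0ℚ ≤ p → 0ℚ ≤ s → p ≤ q → r ≤ s → p * r ≤ q * s
*-mono-≤-nonNeg {p} {q} {r} {s} 0≤p 0≤s p≤q r≤s = ℚP.≤-trans
  (ℚP.*-monoˡ-≤-nonNeg p {{ℚ.nonNegative 0≤p}} r≤s)
  (ℚP.*-monoʳ-≤-nonNeg s {{ℚ.nonNegative 0≤s}} p≤q)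

am-gm : ∀ {p q r} → 0ℚ ≤ p → 0ℚ ≤ q → p + q ≤ r + r → p * q ≤ r * r
am-gm {p} {q} {r} 0≤p 0≤q p+q≤r+r = ℚP.*-cancelˡ-≤-pos four (begin
  four * (p * q)       ≤⟨ 0≤q-p⇒p≤q (subst (0ℚ ≤_) (square-of-difference p q) (0≤p*p (p - q))) ⟩
  (p + q) * (p + q)    ≤⟨ *-mono-≤-nonNeg 0≤s (ℚP.≤-trans 0≤s p+q≤r+r) p+q≤r+r p+q≤r+r ⟩
  (r + r) * (r + r)    ≡⟨ double-square r ⟩
  four * (r * r)       ∎)
  where
  open ℚP.≤-Reasoning
  four = (1ℚ + 1ℚ) * (1ℚ + 1ℚ)
  0≤s = 0≤p+q 0≤p 0≤q
  square-of-difference : ∀ p q → (p - q) * (p - q) ≡ (p + q) * (p + q) - (1ℚ + 1ℚ) * (1ℚ + 1ℚ) * (p * q)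
  square-of-difference = solve-∀ ℚ-ring
  double-square : ∀ r → (r + r) * (r + r) ≡ (1ℚ + 1ℚ) * (1ℚ + 1ℚ) * (r * r)
  double-square = solve-∀ ℚ-ring

-- Natural numbers and binomial coefficients in ℚ

-- The embedding ℕ → ℚ, defined unarily so that ι (suc n) reduces to 1ℚ + ι n and the ring
-- solver can treat ι n as an atom.
ι : ℕ → ℚ
ι zero    = 0ℚ
ι (suc n) = 1ℚ + ι n

0≤ι : ∀ n → 0ℚ ≤ ι n
0≤ι zero    = ℚP.≤-refl
0≤ι (suc n) = 0≤p+q (ℚP.nonNegative⁻¹ 1ℚ) (0≤ι n)

ι-mono-≤ : ∀ {m n} → m ℕ.≤ n → ι m ≤ ι n
ι-mono-≤ {n = n} z≤n = 0≤ι n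
ι-mono-≤ (s≤s m≤n)   = ℚP.+-monoʳ-≤ 1ℚ (ι-mono-≤ m≤n)

ι-+ : ∀ m n → ι (m ℕ.+ n) ≡ ι m + ι n
ι-+ zero    n = sym (ℚP.+-identityˡ (ι n))
ι-+ (suc m) n = trans (cong (1ℚ +_) (ι-+ m n)) (sym (ℚP.+-assoc 1ℚ (ι m) (ι n)))

ι-* : ∀ m n → ι (m ℕ.* n) ≡ ι m * ι n
ι-* zero    n = sym (ℚP.*-zeroˡ (ι n))
ι-* (suc m) n = begin
  ι (n ℕ.+ m ℕ.* n)     ≡⟨ ι-+ n (m ℕ.* n) ⟩
  ι n + ι (m ℕ.* n)     ≡⟨ cong (ι n +_) (ι-* m n) ⟩
  ι n + ι m * ι n       ≡⟨ distrib (ι m) (ι n) ⟩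
  (1ℚ + ι m) * ι n      ∎
  where
  open ≡-Reasoning
  distrib : ∀ a b → b + a * b ≡ (1ℚ + a) * b
  distrib = solve-∀ ℚ-ring

0<ι[1+n] : ∀ n → 0ℚ < ι (suc n)
0<ι[1+n] n = ℚP.+-mono-<-≤ (ℚP.positive⁻¹ 1ℚ) (0≤ι n)

ι≡mkℚ : ∀ n → ι n ≡ mkℚ (ℤ.+ n) 0 (Coprime.sym (Coprime.1-coprimeTo n))
ι≡mkℚ zero    = refl
ι≡mkℚ (suc n) = begin
  1ℚ + ι n             ≡⟨ cong (1ℚ +_) (ι≡mkℚ n) ⟩
  1ℚ + n/1             ≡⟨ ℚP./-cong (cong (ℤ._+_ (ℤ.+ 1)) (ℤP.*-identityʳ (ℤ.+ n))) refl ⟩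
  ℤ.+ suc n / 1        ≡⟨ ℚP.↥p/↧p≡p _ ⟩
  mkℚ (ℤ.+ suc n) 0 _  ∎
  where
  open ≡-Reasoning
  n/1 = mkℚ (ℤ.+ n) 0 (Coprime.sym (Coprime.1-coprimeTo n))

ι≡/1 : ∀ n → ι n ≡ ℤ.+ n / 1
ι≡/1 n = trans (ι≡mkℚ n) (sym (ℚP.↥p/↧p≡p _))

ι-inverse : ∀ n .{{_ : ℕ.NonZero n}} → (ℤ.+ 1 / n) * ι n ≡ 1ℚ
ι-inverse (suc n) = begin
  (ℤ.+ 1 / suc n) * ι (suc n)  ≡⟨ cong₂ _*_ (ℚP.↥p/↧p≡p (ℚ.1/ n+1)) (ι≡mkℚ (suc n)) ⟩
  ℚ.1/ n+1 * n+1               ≡⟨ ℚP.*-inverseˡ n+1 ⟩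
  1ℚ                           ∎
  where
  open ≡-Reasoning
  n+1 = mkℚ (ℤ.+ suc n) 0 (Coprime.sym (Coprime.1-coprimeTo (suc n)))

[k+1]*nC[k+1]+k*nCk≡n*nCk : ∀ n k → suc k ℕ.* (n C suc k) ℕ.+ k ℕ.* (n C k) ≡ n ℕ.* (n C k)
[k+1]*nC[k+1]+k*nCk≡n*nCk zero    zero    = refl
[k+1]*nC[k+1]+k*nCk≡n*nCk zero    (suc k) = cong₂ ℕ._+_ (ℕP.*-zeroʳ (suc (suc k))) (ℕP.*-zeroʳ (suc k))
[k+1]*nC[k+1]+k*nCk≡n*nCk (suc n) zero    = begin
  1 ℕ.* (suc n C 1) ℕ.+ 0  ≡⟨ ℕP.+-identityʳ _ ⟩
  1 ℕ.* (suc n C 1)        ≡⟨ ℕP.*-identityˡ _ ⟩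
  suc n C 1                ≡⟨ nC1≡n (suc n) ⟩
  suc n                    ≡⟨ ℕP.*-identityʳ (suc n) ⟨
  suc n ℕ.* 1              ∎
  where open ≡-Reasoning
[k+1]*nC[k+1]+k*nCk≡n*nCk (suc n) (suc k) = begin
  suc (suc k) ℕ.* (suc n C suc (suc k)) ℕ.+ suc k ℕ.* (suc n C suc k)
    ≡⟨ cong₂ (λ u v → suc (suc k) ℕ.* u ℕ.+ suc k ℕ.* v) (pascal n (suc k)) (pascal n k) ⟨
  suc (suc k) ℕ.* (b ℕ.+ c) ℕ.+ suc k ℕ.* (a ℕ.+ b)
    ≡⟨ regroup k a b c ⟩
  (suc (suc k) ℕ.* c ℕ.+ suc k ℕ.* b) ℕ.+ (suc k ℕ.* b ℕ.+ k ℕ.* a) ℕ.+ (a ℕ.+ b)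
    ≡⟨ cong₂ (λ u v → u ℕ.+ v ℕ.+ (a ℕ.+ b))
             ([k+1]*nC[k+1]+k*nCk≡n*nCk n (suc k)) ([k+1]*nC[k+1]+k*nCk≡n*nCk n k) ⟩
  n ℕ.* b ℕ.+ n ℕ.* a ℕ.+ (a ℕ.+ b)
    ≡⟨ collect n a b ⟩
  suc n ℕ.* (a ℕ.+ b)
    ≡⟨ cong (suc n ℕ.*_) (pascal n k) ⟩
  suc n ℕ.* (suc n C suc k) ∎
  where
  open ≡-Reasoning
  pascal = nCk+nC[k+1]≡[n+1]C[k+1]
  a = n C k
  b = n C suc k
  c = n C suc (suc k)
  regroup : ∀ k a b c → suc (suc k) ℕ.* (b ℕ.+ c) ℕ.+ suc k ℕ.* (a ℕ.+ b)
          ≡ (suc (suc k) ℕ.* c ℕ.+ suc k ℕ.* b) ℕ.+ (suc k ℕ.* b ℕ.+ k ℕ.* a) ℕ.+ (a ℕ.+ b)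
  regroup = ℕ-Solver.solve-∀
  collect : ∀ n a b → n ℕ.* b ℕ.+ n ℕ.* a ℕ.+ (a ℕ.+ b) ≡ suc n ℕ.* (a ℕ.+ b)
  collect = ℕ-Solver.solve-∀

ι[1+k]*ι[nC[k+1]]≡[ι[n]-ι[k]]*ι[nCk] : ∀ n k → ι (suc k) * ι (n C suc k) ≡ (ι n - ι k) * ι (n C k)
ι[1+k]*ι[nC[k+1]]≡[ι[n]-ι[k]]*ι[nCk] n k = begin
  ι (suc k) * ι (n C suc k)
    ≡⟨ isolate (ι (suc k) * ι (n C suc k)) (ι k) (ι (n C k)) ⟩
  (ι (suc k) * ι (n C suc k) + ι k * ι (n C k)) - ι k * ι (n C k)
    ≡⟨ cong (_- ι k * ι (n C k)) absorption ⟩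
  ι n * ι (n C k) - ι k * ι (n C k)
    ≡⟨ factor (ι n) (ι k) (ι (n C k)) ⟩
  (ι n - ι k) * ι (n C k) ∎
  where
  open ≡-Reasoning
  absorption : ι (suc k) * ι (n C suc k) + ι k * ι (n C k) ≡ ι n * ι (n C k)
  absorption = begin
    ι (suc k) * ι (n C suc k) + ι k * ι (n C k)  ≡⟨ cong₂ _+_ (ι-* (suc k) (n C suc k)) (ι-* k (n C k)) ⟨
    ι (suc k ℕ.* (n C suc k)) + ι (k ℕ.* (n C k)) ≡⟨ ι-+ (suc k ℕ.* (n C suc k)) (k ℕ.* (n C k)) ⟨
    ι (suc k ℕ.* (n C suc k) ℕ.+ k ℕ.* (n C k))   ≡⟨ cong ι ([k+1]*nC[k+1]+k*nCk≡n*nCk n k) ⟩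
    ι (n ℕ.* (n C k))                             ≡⟨ ι-* n (n C k) ⟩
    ι n * ι (n C k)                               ∎
  isolate : ∀ p q r → p ≡ (p + q * r) - q * r
  isolate = solve-∀ ℚ-ring
  factor : ∀ p q r → p * r - q * r ≡ (p - q) * r
  factor = solve-∀ ℚ-ring

binomial-ratio-below : ∀ n j →
  ι (suc j) * ι (suc n C suc j) ≡ (ι n - ι (suc j) + 1ℚ + 1ℚ) * ι (suc n C j)
binomial-ratio-below n j =
  trans (ι[1+k]*ι[nC[k+1]]≡[ι[n]-ι[k]]*ι[nCk] (suc n) j) (cong (_* ι (suc n C j)) (shift (ι n) (ι j)))
  where
  shift : ∀ n j → (1ℚ + n) - j ≡ n - (1ℚ + j) + 1ℚ + 1ℚ
  shift = solve-∀ ℚ-ring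

binomial-ratio-above : ∀ n j →
  (ι n - ι (suc j) + 1ℚ) * ι (suc n C suc j) ≡ (ι (suc j) + 1ℚ) * ι (suc n C suc (suc j))
binomial-ratio-above n j = begin
  (ι n - ι (suc j) + 1ℚ) * ι (suc n C suc j)     ≡⟨ cong (_* ι (suc n C suc j)) (shift (ι n) (ι j)) ⟨
  (ι (suc n) - ι (suc j)) * ι (suc n C suc j)    ≡⟨ ι[1+k]*ι[nC[k+1]]≡[ι[n]-ι[k]]*ι[nCk] (suc n) (suc j) ⟨
  ι (suc (suc j)) * ι (suc n C suc (suc j))      ≡⟨ cong (_* ι (suc n C suc (suc j))) (ℚP.+-comm 1ℚ (ι (suc j))) ⟩
  (ι (suc j) + 1ℚ) * ι (suc n C suc (suc j))     ∎
  where
  open ≡-Reasoning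
  shift : ∀ n j → (1ℚ + n) - (1ℚ + j) ≡ n - (1ℚ + j) + 1ℚ
  shift = solve-∀ ℚ-ring

p*b≡q*a⇒p/a≡q/b : ∀ a b .{{_ : ℕ.NonZero a}} .{{_ : ℕ.NonZero b}} p q →
  p * ι b ≡ q * ι a → (ℤ.+ 1 / a) * p ≡ (ℤ.+ 1 / b) * q
p*b≡q*a⇒p/a≡q/b a b p q pb≡qa = begin
  u * p                   ≡⟨ ℚP.*-identityʳ (u * p) ⟨
  u * p * 1ℚ              ≡⟨ cong (u * p *_) (ι-inverse b) ⟨
  u * p * (v * ι b)       ≡⟨ regroup u p v (ι b) ⟩
  v * u * (p * ι b)       ≡⟨ cong (v * u *_) pb≡qa ⟩
  v * u * (q * ι a)       ≡⟨ swap v u q (ι a) ⟩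
  v * q * (u * ι a)       ≡⟨ cong (v * q *_) (ι-inverse a) ⟩
  v * q * 1ℚ              ≡⟨ ℚP.*-identityʳ (v * q) ⟩
  v * q                   ∎
  where
  open ≡-Reasoning
  u = ℤ.+ 1 / a
  v = ℤ.+ 1 / b
  regroup : ∀ u p v b → u * p * (v * b) ≡ v * u * (p * b)
  regroup = solve-∀ ℚ-ring
  swap : ∀ v u q a → v * u * (q * a) ≡ v * q * (u * a)
  swap = solve-∀ ℚ-ring

-- Ultra log-concavity from an averaged bound

-- Ultra log-concavity at k = j + 1 with m = n − k, after clearing the binomial ratios
-- C(n+1,k−1)/C(n+1,k) = k/(m+2) and C(n+1,k+1)/C(n+1,k) = (m+1)/(k+1).
WeightedLogConcave : ℕ → (ℕ → ℚ) → Set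
WeightedLogConcave n c = ∀ j → suc j ℕ.< n →
  let k = ι (suc j); m = ι n - ι (suc j) in
  (k + 1ℚ) * (m + 1ℚ + 1ℚ) * (c j * c (suc (suc j))) ≤ k * (m + 1ℚ) * (c (suc j) * c (suc j))

averaged-bound⇒weighted-log-concave : ∀ {k m x y z} → 0ℚ < k → 0ℚ < m + 1ℚ → 0ℚ ≤ x → 0ℚ ≤ z →
  (m + 1ℚ) * (m + 1ℚ + 1ℚ) * x + k * (k + 1ℚ) * z ≤ (1ℚ + 1ℚ) * k * (m + 1ℚ) * y →
  (k + 1ℚ) * (m + 1ℚ + 1ℚ) * (x * z) ≤ k * (m + 1ℚ) * (y * y)
averaged-bound⇒weighted-log-concave {k} {m} {x} {y} {z} 0<k 0<m+1 0≤x 0≤z bound =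
  ℚP.*-cancelˡ-≤-pos (k * (m + 1ℚ)) {{ℚ.positive (0<p*q 0<k 0<m+1)}} (begin
    k * (m + 1ℚ) * ((k + 1ℚ) * (m + 1ℚ + 1ℚ) * (x * z))  ≡⟨ regroup k m x z ⟩
    a * b                                                 ≤⟨ am-gm {r = r} 0≤a 0≤b a+b≤r+r ⟩
    r * r                                                 ≡⟨ square k (m + 1ℚ) y ⟩
    k * (m + 1ℚ) * (k * (m + 1ℚ) * (y * y))               ∎)
  where
  open ℚP.≤-Reasoning
  a = (m + 1ℚ) * (m + 1ℚ + 1ℚ) * x
  b = k * (k + 1ℚ) * z
  r = k * (m + 1ℚ) * y
  0≤k = ℚP.<⇒≤ 0<k
  0≤m+1 = ℚP.<⇒≤ 0<m+1
  0≤a = 0≤p*q (0≤p*q 0≤m+1 (0≤p+q 0≤m+1 (ℚP.nonNegative⁻¹ 1ℚ))) 0≤x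
  0≤b = 0≤p*q (0≤p*q 0≤k (0≤p+q 0≤k (ℚP.nonNegative⁻¹ 1ℚ))) 0≤z
  regroup : ∀ k m x z → k * (m + 1ℚ) * ((k + 1ℚ) * (m + 1ℚ + 1ℚ) * (x * z))
                      ≡ ((m + 1ℚ) * (m + 1ℚ + 1ℚ) * x) * (k * (k + 1ℚ) * z)
  regroup = solve-∀ ℚ-ring
  double : ∀ k m y → (1ℚ + 1ℚ) * k * (m + 1ℚ) * y ≡ k * (m + 1ℚ) * y + k * (m + 1ℚ) * y
  double = solve-∀ ℚ-ring
  a+b≤r+r = subst (a + b ≤_) (double k m y) bound
  square : ∀ k m y → (k * m * y) * (k * m * y) ≡ k * m * (k * m * (y * y))
  square = solve-∀ ℚ-ring

weighted⇒normalised-log-concave : ∀ {k m x y z u₀ u₁ u₂} → 0ℚ < k → 0ℚ < m + 1ℚ →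
  u₀ * k ≡ u₁ * (m + 1ℚ + 1ℚ) → u₂ * (m + 1ℚ) ≡ u₁ * (k + 1ℚ) →
  (k + 1ℚ) * (m + 1ℚ + 1ℚ) * (x * z) ≤ k * (m + 1ℚ) * (y * y) →
  (x * u₀) * (z * u₂) ≤ (y * u₁) * (y * u₁)
weighted⇒normalised-log-concave {k} {m} {x} {y} {z} {u₀} {u₁} {u₂} 0<k 0<m+1 u₀k≡u₁[m+2] u₂[m+1]≡u₁[k+1] ineq =
  ℚP.*-cancelˡ-≤-pos (k * (m + 1ℚ)) {{ℚ.positive (0<p*q 0<k 0<m+1)}} (begin
    k * (m + 1ℚ) * ((x * u₀) * (z * u₂))
      ≡⟨ regroup k (m + 1ℚ) x z u₀ u₂ ⟩
    (u₀ * k) * (u₂ * (m + 1ℚ)) * (x * z)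
      ≡⟨ cong₂ (λ p q → p * q * (x * z)) u₀k≡u₁[m+2] u₂[m+1]≡u₁[k+1] ⟩
    (u₁ * (m + 1ℚ + 1ℚ)) * (u₁ * (k + 1ℚ)) * (x * z)
      ≡⟨ pull-square u₁ (m + 1ℚ + 1ℚ) (k + 1ℚ) (x * z) ⟩
    (u₁ * u₁) * ((k + 1ℚ) * (m + 1ℚ + 1ℚ) * (x * z))
      ≤⟨ ℚP.*-monoˡ-≤-nonNeg (u₁ * u₁) {{ℚ.nonNegative (0≤p*p u₁)}} ineq ⟩
    (u₁ * u₁) * (k * (m + 1ℚ) * (y * y))
      ≡⟨ push-square u₁ k (m + 1ℚ) y ⟩
    k * (m + 1ℚ) * ((y * u₁) * (y * u₁)) ∎)
  where
  open ℚP.≤-Reasoning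
  regroup : ∀ k m x z u₀ u₂ → k * m * ((x * u₀) * (z * u₂)) ≡ (u₀ * k) * (u₂ * m) * (x * z)
  regroup = solve-∀ ℚ-ring
  pull-square : ∀ u a b w → (u * a) * (u * b) * w ≡ (u * u) * (b * a * w)
  pull-square = solve-∀ ℚ-ring
  push-square : ∀ u k m y → (u * u) * (k * m * (y * y)) ≡ k * m * ((y * u) * (y * u))
  push-square = solve-∀ ℚ-ring

weightedLogConcave⇒ultraLogConcave : ∀ {n c} → WeightedLogConcave n c → UltraLogConcave n c
weightedLogConcave⇒ultraLogConcave wlc zero          ()       _
weightedLogConcave⇒ultraLogConcave wlc (suc zero)    (s≤s ()) _
weightedLogConcave⇒ultraLogConcave {n} {c} wlc (suc (suc i)) _ k<n =
  weighted⇒normalised-log-concave {ι (suc j)} {m} {c j} {c (suc j)} {c (suc (suc j))} {u₀} {u₁} {u₂}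
    (0<ι[1+n] j) (0≤p⇒0<p+1 0≤m)
    u₀k≡u₁[m+2] u₂[m+1]≡u₁[k+1] (wlc j k<n)
  where
  j = suc i
  N = suc n
  instance
    _ : ℕ.NonZero (N C j)
    _ = ℕ.>-nonZero (nCk>0 (ℕP.m≤n⇒m≤1+n (ℕP.≤-trans (ℕP.n≤1+n j) (ℕP.<⇒≤ k<n))))
    _ : ℕ.NonZero (N C suc j)
    _ = ℕ.>-nonZero (nCk>0 (ℕP.m≤n⇒m≤1+n (ℕP.<⇒≤ k<n)))
    _ : ℕ.NonZero (N C suc (suc j))
    _ = ℕ.>-nonZero (nCk>0 (ℕP.m≤n⇒m≤1+n k<n))
  u₀ u₁ u₂ : ℚ
  u₀ = ℤ.+ 1 / (N C j)
  u₁ = ℤ.+ 1 / (N C suc j)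
  u₂ = ℤ.+ 1 / (N C suc (suc j))
  m = ι n - ι (suc j)
  0≤m : 0ℚ ≤ m
  0≤m = p≤q⇒0≤q-p (ι-mono-≤ (ℕP.<⇒≤ k<n))
  u₀k≡u₁[m+2] : u₀ * ι (suc j) ≡ u₁ * (m + 1ℚ + 1ℚ)
  u₀k≡u₁[m+2] = p*b≡q*a⇒p/a≡q/b (N C j) (N C suc j) (ι (suc j)) (m + 1ℚ + 1ℚ) (binomial-ratio-below n j)
  u₂[m+1]≡u₁[k+1] : u₂ * (m + 1ℚ) ≡ u₁ * (ι (suc j) + 1ℚ)
  u₂[m+1]≡u₁[k+1] = p*b≡q*a⇒p/a≡q/b (N C suc (suc j)) (N C suc j) (m + 1ℚ) (ι (suc j) + 1ℚ)
    (binomial-ratio-above n j)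

-- Nonnegative monotone submodular set functions

Monotone : ∀ {n} → (Subset n → ℚ) → Set
Monotone f = ∀ {S T} → S ⊆ T → f S ≤ f T

Submodular : ∀ {n} → (Subset n → ℚ) → Set
Submodular f = ∀ S T → f (S ∪ T) + f (S ∩ T) ≤ f S + f T

record IsNonNegMonotoneSubmodular {n} (f : Subset n → ℚ) : Set where
  field
    nonNegative : ∀ S → 0ℚ ≤ f S
    monotone    : Monotone f
    submodular  : Submodular f

nonNegMonotoneSubmodular-resp-≗ : ∀ {n} {f g : Subset n → ℚ} → f ≗ g →
  IsNonNegMonotoneSubmodular f → IsNonNegMonotoneSubmodular g
nonNegMonotoneSubmodular-resp-≗ {f = f} {g} f≡g isF = record
  { nonNegative = λ S → subst (0ℚ ≤_) (f≡g S) (nonNegative S)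
  ; monotone    = λ {S} {T} S⊆T → subst₂ _≤_ (f≡g S) (f≡g T) (monotone S⊆T)
  ; submodular  = λ S T → subst₂ _≤_ (cong₂ _+_ (f≡g (S ∪ T)) (f≡g (S ∩ T))) (cong₂ _+_ (f≡g S) (f≡g T))
                                     (submodular S T)
  }
  where open IsNonNegMonotoneSubmodular isF

0-nonNegMonotoneSubmodular : ∀ {n} → IsNonNegMonotoneSubmodular {n} (λ _ → 0ℚ)
0-nonNegMonotoneSubmodular = record
  { nonNegative = λ _ → ℚP.≤-refl
  ; monotone    = λ _ → ℚP.≤-refl
  ; submodular  = λ _ _ → ℚP.≤-refl
  }

+-nonNegMonotoneSubmodular : ∀ {n} {f g : Subset n → ℚ} →
  IsNonNegMonotoneSubmodular f → IsNonNegMonotoneSubmodular g → IsNonNegMonotoneSubmodular (λ S → f S + g S)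
+-nonNegMonotoneSubmodular {f = f} {g} isF isG = record
  { nonNegative = λ S → 0≤p+q (F.nonNegative S) (G.nonNegative S)
  ; monotone    = λ S⊆T → ℚP.+-mono-≤ (F.monotone S⊆T) (G.monotone S⊆T)
  ; submodular  = λ S T → begin
      (f (S ∪ T) + g (S ∪ T)) + (f (S ∩ T) + g (S ∩ T))  ≡⟨ interchange (f (S ∪ T)) _ _ _ ⟩
      (f (S ∪ T) + f (S ∩ T)) + (g (S ∪ T) + g (S ∩ T))  ≤⟨ ℚP.+-mono-≤ (F.submodular S T) (G.submodular S T) ⟩
      (f S + f T) + (g S + g T)                          ≡⟨ interchange (f S) _ _ _ ⟩
      (f S + g S) + (f T + g T)                          ∎
  }
  where
  open ℚP.≤-Reasoning
  module F = IsNonNegMonotoneSubmodular isF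
  module G = IsNonNegMonotoneSubmodular isG

module _ {n} {S T : Subset n} where

  p⊆q⇒p∪q≡q : S ⊆ T → S ∪ T ≡ T
  p⊆q⇒p∪q≡q S⊆T = ⊆-antisym (λ x∈S∪T → [ S⊆T , id ]′ (x∈p∪q⁻ S T x∈S∪T)) (q⊆p∪q S T)

  p⊆q⇒p∩q≡p : S ⊆ T → S ∩ T ≡ S
  p⊆q⇒p∩q≡p S⊆T = ⊆-antisym (p∩q⊆p S T) (λ x∈S → x∈p∩q⁺ (x∈S , S⊆T x∈S))

monotone-∷ : ∀ {n} {f : Subset (suc n) → ℚ} b → Monotone f → Monotone (f ∘ (b ∷_))
monotone-∷ b mono S⊆T = mono (s⊆s S⊆T)

monotone⇒out≤in : ∀ {n} {f : Subset (suc n) → ℚ} → Monotone f → ∀ S → f (false ∷ S) ≤ f (true ∷ S)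
monotone⇒out≤in mono S = mono (out⊆ ⊆-refl)

submodular-∷ : ∀ {n} {f : Subset (suc n) → ℚ} b → Submodular f → Submodular (f ∘ (b ∷_))
submodular-∷ false sub S T = sub (false ∷ S) (false ∷ T)
submodular-∷ true  sub S T = sub (true ∷ S) (true ∷ T)

submodular⇒diminishing-returns : ∀ {n} {f : Subset (suc n) → ℚ} → Submodular f →
  Monotone (λ S → f (false ∷ S) - f (true ∷ S))
submodular⇒diminishing-returns {f = f} sub {S} {T} S⊆T = 0≤q-p⇒p≤q (subst (0ℚ ≤_)
  (rearrange (f (true ∷ T)) (f (false ∷ S)) (f (true ∷ S)) (f (false ∷ T)))
  (p≤q⇒0≤q-p (subst₂ (λ U V → f (true ∷ U) + f (false ∷ V) ≤ f (true ∷ S) + f (false ∷ T))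
    (p⊆q⇒p∪q≡q S⊆T) (p⊆q⇒p∩q≡p S⊆T) (sub (true ∷ S) (false ∷ T)))))
  where
  rearrange : ∀ a b c d → (c + d) - (a + b) ≡ (d - a) - (b - c)
  rearrange = solve-∀ ℚ-ring

-- Coverage functions and sums of matroid ranks

x∈bigUnion⁺ : ∀ {n m} {A : Fin n → Subset m} {T i u} → i ∈ T → u ∈ A i → u ∈ bigUnion A T
x∈bigUnion⁺ {T = true  ∷ T} here        u∈Aᵢ = x∈p∪q⁺ (inj₁ u∈Aᵢ)
x∈bigUnion⁺ {T = true  ∷ T} (there i∈T) u∈Aᵢ = x∈p∪q⁺ (inj₂ (x∈bigUnion⁺ i∈T u∈Aᵢ))
x∈bigUnion⁺ {T = false ∷ T} (there i∈T) u∈Aᵢ = x∈bigUnion⁺ i∈T u∈Aᵢ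

x∈bigUnion⁻ : ∀ {n m} (A : Fin n → Subset m) T {u} → u ∈ bigUnion A T → ∃ λ i → i ∈ T × u ∈ A i
x∈bigUnion⁻ A []          u∈⊥ = contradiction u∈⊥ ∉⊥
x∈bigUnion⁻ A (false ∷ T) u∈⋃ with x∈bigUnion⁻ (A ∘ suc) T u∈⋃
... | i , i∈T , u∈Aᵢ = suc i , there i∈T , u∈Aᵢ
x∈bigUnion⁻ A (true ∷ T)  u∈⋃ with x∈p∪q⁻ (A zero) (bigUnion (A ∘ suc) T) u∈⋃
... | inj₁ u∈A₀ = zero , here , u∈A₀
... | inj₂ u∈⋃′ with x∈bigUnion⁻ (A ∘ suc) T u∈⋃′
...   | i , i∈T , u∈Aᵢ = suc i , there i∈T , u∈Aᵢ

bigUnion-mono : ∀ {n m} (A : Fin n → Subset m) {S T} → S ⊆ T → bigUnion A S ⊆ bigUnion A T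
bigUnion-mono A {S} S⊆T u∈⋃ with x∈bigUnion⁻ A S u∈⋃
... | i , i∈S , u∈Aᵢ = x∈bigUnion⁺ (S⊆T i∈S) u∈Aᵢ

module _ {n m} (A : Fin n → Subset m) {S T : Subset n} where

  bigUnion-∪ : bigUnion A (S ∪ T) ⊆ bigUnion A S ∪ bigUnion A T
  bigUnion-∪ u∈⋃ with x∈bigUnion⁻ A (S ∪ T) u∈⋃
  ... | i , i∈S∪T , u∈Aᵢ = x∈p∪q⁺ (Sum.map (λ i∈S → x∈bigUnion⁺ i∈S u∈Aᵢ) (λ i∈T → x∈bigUnion⁺ i∈T u∈Aᵢ)
                                             (x∈p∪q⁻ S T i∈S∪T))

  bigUnion-∩ : bigUnion A (S ∩ T) ⊆ bigUnion A S ∩ bigUnion A T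
  bigUnion-∩ u∈⋃ = x∈p∩q⁺ (bigUnion-mono A (p∩q⊆p S T) u∈⋃ , bigUnion-mono A (p∩q⊆q S T) u∈⋃)

0≤measure : ∀ {m} {w : Fin m → ℚ} → (∀ u → 0ℚ ≤ w u) → ∀ X → 0ℚ ≤ measure w X
0≤measure w≥0 []          = ℚP.≤-refl
0≤measure w≥0 (false ∷ X) = 0≤p+q ℚP.≤-refl (0≤measure (w≥0 ∘ suc) X)
0≤measure w≥0 (true  ∷ X) = 0≤p+q (w≥0 zero) (0≤measure (w≥0 ∘ suc) X)

measure-mono : ∀ {m} {w : Fin m → ℚ} → (∀ u → 0ℚ ≤ w u) → ∀ {X Y} → X ⊆ Y → measure w X ≤ measure w Y
measure-mono w≥0 {[]}        {[]}        _   = ℚP.≤-refl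
measure-mono w≥0 {true  ∷ X} {false ∷ Y} X⊆Y = contradiction (X⊆Y here) λ ()
measure-mono {w = w} w≥0 {true ∷ X} {true ∷ Y} X⊆Y =
  ℚP.+-monoʳ-≤ (w zero) (measure-mono (w≥0 ∘ suc) (drop-∷-⊆ X⊆Y))
measure-mono w≥0 {false ∷ X} {false ∷ Y} X⊆Y =
  ℚP.+-monoʳ-≤ 0ℚ (measure-mono (w≥0 ∘ suc) (drop-∷-⊆ X⊆Y))
measure-mono w≥0 {false ∷ X} {true  ∷ Y} X⊆Y =
  ℚP.+-mono-≤ (w≥0 zero) (measure-mono (w≥0 ∘ suc) (drop-∷-⊆ X⊆Y))

measure-∪-∩ : ∀ {m} (w : Fin m → ℚ) X Y → measure w (X ∪ Y) + measure w (X ∩ Y) ≡ measure w X + measure w Y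
measure-∪-∩ w []      []      = refl
measure-∪-∩ w (x ∷ X) (y ∷ Y) = begin
  (χ (x ∨ y) + μ (X ∪ Y)) + (χ (x ∧ y) + μ (X ∩ Y))  ≡⟨ interchange (χ (x ∨ y)) _ _ _ ⟩
  (χ (x ∨ y) + χ (x ∧ y)) + (μ (X ∪ Y) + μ (X ∩ Y))  ≡⟨ cong₂ _+_ (χ-∨-∧ x y) (measure-∪-∩ (w ∘ suc) X Y) ⟩
  (χ x + χ y) + (μ X + μ Y)                          ≡⟨ interchange (χ x) _ _ _ ⟩
  (χ x + μ X) + (χ y + μ Y)                          ∎
  where
  open ≡-Reasoning
  μ = measure (w ∘ suc)
  χ : Bool → ℚ
  χ b = if b then w zero else 0ℚ
  χ-∨-∧ : ∀ x y → χ (x ∨ y) + χ (x ∧ y) ≡ χ x + χ y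
  χ-∨-∧ true  true  = refl
  χ-∨-∧ true  false = refl
  χ-∨-∧ false true  = ℚP.+-comm (w zero) 0ℚ
  χ-∨-∧ false false = refl

coverage⇒nonNegMonotoneSubmodular : ∀ {n} {f : Subset n → ℚ} → IsCoverage f → IsNonNegMonotoneSubmodular f
coverage⇒nonNegMonotoneSubmodular (m , A , w , w≥0 , f≡) = nonNegMonotoneSubmodular-resp-≗ (sym ∘ f≡) (record
  { nonNegative = 0≤measure w≥0 ∘ bigUnion A
  ; monotone    = measure-mono w≥0 ∘ bigUnion-mono A
  ; submodular  = λ S T → begin
      measure w (bigUnion A (S ∪ T)) + measure w (bigUnion A (S ∩ T))
        ≤⟨ ℚP.+-mono-≤ (measure-mono w≥0 (bigUnion-∪ A)) (measure-mono w≥0 (bigUnion-∩ A)) ⟩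
      measure w (bigUnion A S ∪ bigUnion A T) + measure w (bigUnion A S ∩ bigUnion A T)
        ≡⟨ measure-∪-∩ w (bigUnion A S) (bigUnion A T) ⟩
      measure w (bigUnion A S) + measure w (bigUnion A T) ∎
  })
  where open ℚP.≤-Reasoning

matroidRank⇒nonNegMonotoneSubmodular : ∀ {n} {r : Subset n → ℕ} → IsMatroidRank r →
  IsNonNegMonotoneSubmodular (ι ∘ r)
matroidRank⇒nonNegMonotoneSubmodular {r = r} isRank = record
  { nonNegative = 0≤ι ∘ r
  ; monotone    = ι-mono-≤ ∘ monotone
  ; submodular  = λ S T → subst₂ _≤_ (ι-+ (r (S ∪ T)) (r (S ∩ T))) (ι-+ (r S) (r T)) (ι-mono-≤ (submodular S T))
  }
  where open IsMatroidRank isRank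

rankSum-nonNegMonotoneSubmodular : ∀ {n} (rs : List (Subset n → ℕ)) → (∀ {r} → r ∈ₗ rs → IsMatroidRank r) →
  IsNonNegMonotoneSubmodular (λ T → ι (foldr (λ r acc → r T ℕ.+ acc) 0 rs))
rankSum-nonNegMonotoneSubmodular []       _      = 0-nonNegMonotoneSubmodular
rankSum-nonNegMonotoneSubmodular (r ∷ rs) isRank =
  nonNegMonotoneSubmodular-resp-≗ (λ T → sym (ι-+ (r T) _))
    (+-nonNegMonotoneSubmodular (matroidRank⇒nonNegMonotoneSubmodular (isRank (Any.here refl)))
                                (rankSum-nonNegMonotoneSubmodular rs (isRank ∘ Any.there)))

sumOfMatroidRanks⇒nonNegMonotoneSubmodular : ∀ {n} {f : Subset n → ℚ} → IsSumOfMatroidRanks f →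
  IsNonNegMonotoneSubmodular f
sumOfMatroidRanks⇒nonNegMonotoneSubmodular (rs , isRank , f≡) =
  nonNegMonotoneSubmodular-resp-≗ (λ T → trans (ι≡/1 (foldr (λ r acc → r T ℕ.+ acc) 0 rs)) (sym (f≡ T)))
    (rankSum-nonNegMonotoneSubmodular rs isRank)

-- Level sums and their difference sums

sumℚ-++ : ∀ xs ys → sumℚ (xs ++ ys) ≡ sumℚ xs + sumℚ ys
sumℚ-++ []       ys = sym (ℚP.+-identityˡ (sumℚ ys))
sumℚ-++ (x ∷ xs) ys = trans (cong (x +_) (sumℚ-++ xs ys)) (sym (ℚP.+-assoc x (sumℚ xs) (sumℚ ys)))

sumℚ-map-filter : ∀ {A : Set} {P : Pred A 0ℓ} (P? : Decidable P) (g : A → ℚ) xs →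
  sumℚ (map g (filter P? xs)) ≡ sumℚ (map (λ x → if does (P? x) then g x else 0ℚ) xs)
sumℚ-map-filter P? g []       = refl
sumℚ-map-filter P? g (x ∷ xs) with does (P? x)
... | true  = cong (g x +_) (sumℚ-map-filter P? g xs)
... | false = trans (sumℚ-map-filter P? g xs) (sym (ℚP.+-identityˡ _))

sumℚ-map-0 : ∀ {A : Set} (xs : List A) → sumℚ (map (λ _ → 0ℚ) xs) ≡ 0ℚ
sumℚ-map-0 []       = refl
sumℚ-map-0 (x ∷ xs) = trans (ℚP.+-identityˡ _) (sumℚ-map-0 xs)

sumℚ-map-mono : ∀ {A : Set} {g h : A → ℚ} → (∀ x → g x ≤ h x) → ∀ xs → sumℚ (map g xs) ≤ sumℚ (map h xs)
sumℚ-map-mono g≤h []       = ℚP.≤-refl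
sumℚ-map-mono g≤h (x ∷ xs) = ℚP.+-mono-≤ (g≤h x) (sumℚ-map-mono g≤h xs)

0≤sumℚ-map : ∀ {A : Set} {g : A → ℚ} → (∀ x → 0ℚ ≤ g x) → ∀ xs → 0ℚ ≤ sumℚ (map g xs)
0≤sumℚ-map 0≤g []       = ℚP.≤-refl
0≤sumℚ-map 0≤g (x ∷ xs) = 0≤p+q (0≤g x) (0≤sumℚ-map 0≤g xs)

sumℚ-map-- : ∀ {A : Set} (g h : A → ℚ) xs →
  sumℚ (map (λ x → g x - h x) xs) ≡ sumℚ (map g xs) - sumℚ (map h xs)
sumℚ-map-- g h []       = refl
sumℚ-map-- g h (x ∷ xs) =
  trans (cong (g x - h x +_) (sumℚ-map-- g h xs)) (regroup (g x) (h x) (sumℚ (map g xs)) (sumℚ (map h xs)))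
  where
  regroup : ∀ a b c d → a - b + (c - d) ≡ (a + c) - (b + d)
  regroup = solve-∀ ℚ-ring

sumℚ-map-allSubsets : ∀ n (g : Subset (suc n) → ℚ) → sumℚ (map g (allSubsets (suc n)))
  ≡ sumℚ (map (g ∘ (false ∷_)) (allSubsets n)) + sumℚ (map (g ∘ (true ∷_)) (allSubsets n))
sumℚ-map-allSubsets n g = begin
  sumℚ (map g (map (false ∷_) Ss ++ map (true ∷_) Ss))
    ≡⟨ cong sumℚ (map-++ g (map (false ∷_) Ss) (map (true ∷_) Ss)) ⟩
  sumℚ (map g (map (false ∷_) Ss) ++ map g (map (true ∷_) Ss))
    ≡⟨ sumℚ-++ (map g (map (false ∷_) Ss)) (map g (map (true ∷_) Ss)) ⟩
  sumℚ (map g (map (false ∷_) Ss)) + sumℚ (map g (map (true ∷_) Ss))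
    ≡⟨ cong₂ (λ xs ys → sumℚ xs + sumℚ ys) (map-∘ Ss) (map-∘ Ss) ⟨
  sumℚ (map (g ∘ (false ∷_)) Ss) + sumℚ (map (g ∘ (true ∷_)) Ss) ∎
  where
  open ≡-Reasoning
  Ss = allSubsets n

onLevel : ∀ {n} → ℕ → (Subset n → ℚ) → Subset n → ℚ
onLevel i f S = if ∣ S ∣ ℕ.≡ᵇ i then f S else 0ℚ

levelSum≡sumℚ-onLevel : ∀ n (f : Subset n → ℚ) i → levelSum n f i ≡ sumℚ (map (onLevel i f) (allSubsets n))
levelSum≡sumℚ-onLevel n f i = sumℚ-map-filter (λ S → ∣ S ∣ ℕ.≟ i) f (allSubsets n)

levelSum-suc : ∀ n (f : Subset (suc n) → ℚ) i →
  levelSum (suc n) f (suc i) ≡ levelSum n (f ∘ (false ∷_)) (suc i) + levelSum n (f ∘ (true ∷_)) i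
levelSum-suc n f i = begin
  levelSum (suc n) f (suc i)
    ≡⟨ levelSum≡sumℚ-onLevel (suc n) f (suc i) ⟩
  sumℚ (map (onLevel (suc i) f) (allSubsets (suc n)))
    ≡⟨ sumℚ-map-allSubsets n (onLevel (suc i) f) ⟩
  sumℚ (map (onLevel (suc i) (f ∘ (false ∷_))) (allSubsets n))
    + sumℚ (map (onLevel i (f ∘ (true ∷_))) (allSubsets n))
    ≡⟨ cong₂ _+_ (levelSum≡sumℚ-onLevel n (f ∘ (false ∷_)) (suc i))
                 (levelSum≡sumℚ-onLevel n (f ∘ (true ∷_)) i) ⟨
  levelSum n (f ∘ (false ∷_)) (suc i) + levelSum n (f ∘ (true ∷_)) i ∎
  where open ≡-Reasoning

levelSum-zero : ∀ n (f : Subset (suc n) → ℚ) → levelSum (suc n) f zero ≡ levelSum n (f ∘ (false ∷_)) zero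
levelSum-zero n f = begin
  levelSum (suc n) f zero
    ≡⟨ levelSum≡sumℚ-onLevel (suc n) f zero ⟩
  sumℚ (map (onLevel zero f) (allSubsets (suc n)))
    ≡⟨ sumℚ-map-allSubsets n (onLevel zero f) ⟩
  L₀ + sumℚ (map (λ _ → 0ℚ) (allSubsets n))
    ≡⟨ cong (L₀ +_) (sumℚ-map-0 (allSubsets n)) ⟩
  L₀ + 0ℚ
    ≡⟨ ℚP.+-identityʳ L₀ ⟩
  L₀
    ≡⟨ levelSum≡sumℚ-onLevel n (f ∘ (false ∷_)) zero ⟨
  levelSum n (f ∘ (false ∷_)) zero ∎
  where
  open ≡-Reasoning
  L₀ = sumℚ (map (onLevel zero (f ∘ (false ∷_))) (allSubsets n))

levelSum-mono : ∀ n {f g : Subset n → ℚ} → (∀ S → f S ≤ g S) → ∀ i → levelSum n f i ≤ levelSum n g i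
levelSum-mono n f≤g i = sumℚ-map-mono f≤g (filter (λ S → ∣ S ∣ ℕ.≟ i) (allSubsets n))

0≤levelSum : ∀ n {f : Subset n → ℚ} → (∀ S → 0ℚ ≤ f S) → ∀ i → 0ℚ ≤ levelSum n f i
0≤levelSum n 0≤f i = 0≤sumℚ-map 0≤f (filter (λ S → ∣ S ∣ ℕ.≟ i) (allSubsets n))

levelSum-- : ∀ n (f g : Subset n → ℚ) i → levelSum n (λ S → f S - g S) i ≡ levelSum n f i - levelSum n g i
levelSum-- n f g i = sumℚ-map-- f g (filter (λ S → ∣ S ∣ ℕ.≟ i) (allSubsets n))

-- Double counting: the sum over all pairs S ⊂ T with |S| = j, |T| = j + 1 of g T − g S,
-- as every T has j + 1 such S and every S has n − j such T.
firstDifferenceSum : (n : ℕ) → (Subset n → ℚ) → ℕ → ℚ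
firstDifferenceSum n g j = ι (suc j) * levelSum n g (suc j) - (ι n - ι j) * levelSum n g j

-- Likewise the sum over |S| = j and ordered pairs a ≠ b outside S of
-- f (S + a) + f (S + b) − f S − f (S + a + b).
secondDifferenceSum : (n : ℕ) → (Subset n → ℚ) → ℕ → ℚ
secondDifferenceSum n f j =
    (1ℚ + 1ℚ) * ι (suc j) * (ι n - ι (suc j)) * levelSum n f (suc j)
  - ι (suc j) * ι (suc (suc j)) * levelSum n f (suc (suc j))
  - (ι n - ι j) * (ι n - ι (suc j)) * levelSum n f j

module _ {n} (g : Subset (suc n) → ℚ) where
  private
    g₀ g₁ : Subset n → ℚ
    g₀ = g ∘ (false ∷_)
    g₁ = g ∘ (true ∷_)

  firstDifferenceSum-suc-zero : firstDifferenceSum (suc n) g zero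
    ≡ firstDifferenceSum n g₀ zero + (levelSum n g₁ zero - levelSum n g₀ zero)
  firstDifferenceSum-suc-zero rewrite levelSum-suc n g zero | levelSum-zero n g =
    split (ι n) (levelSum n g₀ 0) (levelSum n g₀ 1) (levelSum n g₁ 0)
    where
    split : ∀ N a₀ a₁ b₀ → (1ℚ + 0ℚ) * (a₁ + b₀) - ((1ℚ + N) - 0ℚ) * a₀
                         ≡ ((1ℚ + 0ℚ) * a₁ - (N - 0ℚ) * a₀) + (b₀ - a₀)
    split = solve-∀ ℚ-ring

  firstDifferenceSum-suc : ∀ j → firstDifferenceSum (suc n) g (suc j)
    ≡ firstDifferenceSum n g₀ (suc j) + firstDifferenceSum n g₁ j + (levelSum n g₁ (suc j) - levelSum n g₀ (suc j))
  firstDifferenceSum-suc j rewrite levelSum-suc n g (suc j) | levelSum-suc n g j =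
    split (ι n) (ι j) (levelSum n g₀ (suc j)) (levelSum n g₀ (suc (suc j))) (levelSum n g₁ j) (levelSum n g₁ (suc j))
    where
    split : ∀ N J a₁ a₂ b₀ b₁ →
        (1ℚ + (1ℚ + J)) * (a₂ + b₁) - ((1ℚ + N) - (1ℚ + J)) * (a₁ + b₀)
      ≡ ((1ℚ + (1ℚ + J)) * a₂ - (N - (1ℚ + J)) * a₁) + ((1ℚ + J) * b₁ - (N - J) * b₀) + (b₁ - a₁)
    split = solve-∀ ℚ-ring

0≤firstDifferenceSum : ∀ n {g : Subset n → ℚ} → Monotone g → ∀ j → 0ℚ ≤ firstDifferenceSum n g j
0≤firstDifferenceSum zero    {g} _    zero    = ℚP.≤-reflexive (sym (vanish (g [])))
  where
  vanish : ∀ x → (1ℚ + 0ℚ) * 0ℚ - (0ℚ - 0ℚ) * (x + 0ℚ) ≡ 0ℚ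
  vanish = solve-∀ ℚ-ring
0≤firstDifferenceSum zero    _        (suc j) = ℚP.≤-reflexive (sym (vanish (ι j)))
  where
  vanish : ∀ J → (1ℚ + (1ℚ + J)) * 0ℚ - (0ℚ - (1ℚ + J)) * 0ℚ ≡ 0ℚ
  vanish = solve-∀ ℚ-ring
0≤firstDifferenceSum (suc n) {g} mono zero    = subst (0ℚ ≤_) (sym (firstDifferenceSum-suc-zero g))
  (0≤p+q (0≤firstDifferenceSum n (monotone-∷ false mono) zero)
         (p≤q⇒0≤q-p (levelSum-mono n (monotone⇒out≤in mono) zero)))
0≤firstDifferenceSum (suc n) {g} mono (suc j) = subst (0ℚ ≤_) (sym (firstDifferenceSum-suc g j))
  (0≤p+q (0≤p+q (0≤firstDifferenceSum n (monotone-∷ false mono) (suc j))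
                (0≤firstDifferenceSum n (monotone-∷ true mono) j))
         (p≤q⇒0≤q-p (levelSum-mono n (monotone⇒out≤in mono) (suc j))))

firstDifferenceSum-- : ∀ n (g h : Subset n → ℚ) j →
  firstDifferenceSum n (λ S → g S - h S) j ≡ firstDifferenceSum n g j - firstDifferenceSum n h j
firstDifferenceSum-- n g h j rewrite levelSum-- n g h (suc j) | levelSum-- n g h j =
  distrib (ι (suc j)) (ι n - ι j) (levelSum n g j) (levelSum n g (suc j)) (levelSum n h j) (levelSum n h (suc j))
  where
  distrib : ∀ K M a₀ a₁ b₀ b₁ → K * (a₁ - b₁) - M * (a₀ - b₀) ≡ (K * a₁ - M * a₀) - (K * b₁ - M * b₀)
  distrib = solve-∀ ℚ-ring

module _ {n} (f : Subset (suc n) → ℚ) where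
  private
    f₀ f₁ : Subset n → ℚ
    f₀ = f ∘ (false ∷_)
    f₁ = f ∘ (true ∷_)

  secondDifferenceSum-suc-zero : secondDifferenceSum (suc n) f zero
    ≡ secondDifferenceSum n f₀ zero + (1ℚ + 1ℚ) * (firstDifferenceSum n f₀ zero - firstDifferenceSum n f₁ zero)
  secondDifferenceSum-suc-zero rewrite levelSum-suc n f 1 | levelSum-suc n f 0 | levelSum-zero n f =
    split (ι n) (levelSum n f₀ 0) (levelSum n f₀ 1) (levelSum n f₀ 2) (levelSum n f₁ 0) (levelSum n f₁ 1)
    where
    split : ∀ N a₀ a₁ a₂ b₀ b₁ →
        (1ℚ + 1ℚ) * (1ℚ + 0ℚ) * ((1ℚ + N) - (1ℚ + 0ℚ)) * (a₁ + b₀)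
      - (1ℚ + 0ℚ) * (1ℚ + (1ℚ + 0ℚ)) * (a₂ + b₁)
      - ((1ℚ + N) - 0ℚ) * ((1ℚ + N) - (1ℚ + 0ℚ)) * a₀
      ≡ ((1ℚ + 1ℚ) * (1ℚ + 0ℚ) * (N - (1ℚ + 0ℚ)) * a₁
        - (1ℚ + 0ℚ) * (1ℚ + (1ℚ + 0ℚ)) * a₂
        - (N - 0ℚ) * (N - (1ℚ + 0ℚ)) * a₀)
      + (1ℚ + 1ℚ) * (((1ℚ + 0ℚ) * a₁ - (N - 0ℚ) * a₀) - ((1ℚ + 0ℚ) * b₁ - (N - 0ℚ) * b₀))
    split = solve-∀ ℚ-ring

  secondDifferenceSum-suc : ∀ j → secondDifferenceSum (suc n) f (suc j)
    ≡ secondDifferenceSum n f₀ (suc j) + secondDifferenceSum n f₁ j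
      + (1ℚ + 1ℚ) * (firstDifferenceSum n f₀ (suc j) - firstDifferenceSum n f₁ (suc j))
  secondDifferenceSum-suc j
    rewrite levelSum-suc n f (suc (suc j)) | levelSum-suc n f (suc j) | levelSum-suc n f j =
    split (ι n) (ι j) (levelSum n f₀ (suc j)) (levelSum n f₀ (suc (suc j))) (levelSum n f₀ (suc (suc (suc j))))
          (levelSum n f₁ j) (levelSum n f₁ (suc j)) (levelSum n f₁ (suc (suc j)))
    where
    split : ∀ N J a₁ a₂ a₃ b₀ b₁ b₂ →
        (1ℚ + 1ℚ) * (1ℚ + (1ℚ + J)) * ((1ℚ + N) - (1ℚ + (1ℚ + J))) * (a₂ + b₁)
      - (1ℚ + (1ℚ + J)) * (1ℚ + (1ℚ + (1ℚ + J))) * (a₃ + b₂)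
      - ((1ℚ + N) - (1ℚ + J)) * ((1ℚ + N) - (1ℚ + (1ℚ + J))) * (a₁ + b₀)
      ≡ ((1ℚ + 1ℚ) * (1ℚ + (1ℚ + J)) * (N - (1ℚ + (1ℚ + J))) * a₂
        - (1ℚ + (1ℚ + J)) * (1ℚ + (1ℚ + (1ℚ + J))) * a₃
        - (N - (1ℚ + J)) * (N - (1ℚ + (1ℚ + J))) * a₁)
      + ((1ℚ + 1ℚ) * (1ℚ + J) * (N - (1ℚ + J)) * b₁
        - (1ℚ + J) * (1ℚ + (1ℚ + J)) * b₂
        - (N - J) * (N - (1ℚ + J)) * b₀)
      + (1ℚ + 1ℚ) * (((1ℚ + (1ℚ + J)) * a₂ - (N - (1ℚ + J)) * a₁) - ((1ℚ + (1ℚ + J)) * b₂ - (N - (1ℚ + J)) * b₁))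
    split = solve-∀ ℚ-ring

submodular⇒firstDifferenceSum-in≤out : ∀ n {f : Subset (suc n) → ℚ} → Submodular f → ∀ j →
  firstDifferenceSum n (f ∘ (true ∷_)) j ≤ firstDifferenceSum n (f ∘ (false ∷_)) j
submodular⇒firstDifferenceSum-in≤out n {f} sub j = 0≤q-p⇒p≤q (subst (0ℚ ≤_)
  (firstDifferenceSum-- n (f ∘ (false ∷_)) (f ∘ (true ∷_)) j)
  (0≤firstDifferenceSum n (submodular⇒diminishing-returns {f = f} sub) j))

0≤secondDifferenceSum : ∀ n {f : Subset n → ℚ} → Submodular f → ∀ j → 0ℚ ≤ secondDifferenceSum n f j
0≤secondDifferenceSum zero    {f} _   zero    = ℚP.≤-reflexive (sym (vanish (f [])))
  where
  vanish : ∀ x → (1ℚ + 1ℚ) * (1ℚ + 0ℚ) * (0ℚ - (1ℚ + 0ℚ)) * 0ℚ - (1ℚ + 0ℚ) * (1ℚ + (1ℚ + 0ℚ)) * 0ℚ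
                 - (0ℚ - 0ℚ) * (0ℚ - (1ℚ + 0ℚ)) * (x + 0ℚ) ≡ 0ℚ
  vanish = solve-∀ ℚ-ring
0≤secondDifferenceSum zero    _       (suc j) = ℚP.≤-reflexive (sym (vanish (ι j)))
  where
  vanish : ∀ J → (1ℚ + 1ℚ) * (1ℚ + (1ℚ + J)) * (0ℚ - (1ℚ + (1ℚ + J))) * 0ℚ
                 - (1ℚ + (1ℚ + J)) * (1ℚ + (1ℚ + (1ℚ + J))) * 0ℚ
                 - (0ℚ - (1ℚ + J)) * (0ℚ - (1ℚ + (1ℚ + J))) * 0ℚ ≡ 0ℚ
  vanish = solve-∀ ℚ-ring
0≤secondDifferenceSum (suc n) {f} sub zero    = subst (0ℚ ≤_) (sym (secondDifferenceSum-suc-zero f))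
  (0≤p+q (0≤secondDifferenceSum n (submodular-∷ {f = f} false sub) zero)
         (0≤p*q 0≤2 (p≤q⇒0≤q-p (submodular⇒firstDifferenceSum-in≤out n {f} sub zero))))
0≤secondDifferenceSum (suc n) {f} sub (suc j) = subst (0ℚ ≤_) (sym (secondDifferenceSum-suc f j))
  (0≤p+q (0≤p+q (0≤secondDifferenceSum n (submodular-∷ {f = f} false sub) (suc j))
                (0≤secondDifferenceSum n (submodular-∷ {f = f} true sub) j))
         (0≤p*q 0≤2 (p≤q⇒0≤q-p (submodular⇒firstDifferenceSum-in≤out n {f} sub (suc j)))))

nonNegMonotoneSubmodular⇒averaged-bound : ∀ {n} {f : Subset n → ℚ} → IsNonNegMonotoneSubmodular f → ∀ j →
  let k = ι (suc j); m = ι n - ι (suc j) in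
  (m + 1ℚ) * (m + 1ℚ + 1ℚ) * levelSum n f j + k * (k + 1ℚ) * levelSum n f (suc (suc j))
    ≤ (1ℚ + 1ℚ) * k * (m + 1ℚ) * levelSum n f (suc j)
nonNegMonotoneSubmodular⇒averaged-bound {n} {f} isF j = 0≤q-p⇒p≤q (subst (0ℚ ≤_)
  (combine (ι n) (ι j) (levelSum n f j) (levelSum n f (suc j)) (levelSum n f (suc (suc j))))
  (0≤p+q (0≤secondDifferenceSum n submodular j) (0≤p*q 0≤2 (0≤firstDifferenceSum n {f} monotone j))))
  where
  open IsNonNegMonotoneSubmodular isF
  combine : ∀ N J x y z →
      ((1ℚ + 1ℚ) * (1ℚ + J) * (N - (1ℚ + J)) * y - (1ℚ + J) * (1ℚ + (1ℚ + J)) * z - (N - J) * (N - (1ℚ + J)) * x)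
      + (1ℚ + 1ℚ) * ((1ℚ + J) * y - (N - J) * x)
    ≡ (1ℚ + 1ℚ) * (1ℚ + J) * (N - (1ℚ + J) + 1ℚ) * y
      - ((N - (1ℚ + J) + 1ℚ) * (N - (1ℚ + J) + 1ℚ + 1ℚ) * x + (1ℚ + J) * ((1ℚ + J) + 1ℚ) * z)
  combine = solve-∀ ℚ-ring

nonNegMonotoneSubmodular⇒weightedLogConcave : ∀ {n} {f : Subset n → ℚ} → IsNonNegMonotoneSubmodular f →
  WeightedLogConcave n (levelSum n f)
nonNegMonotoneSubmodular⇒weightedLogConcave {n} isF j j+1<n =
  averaged-bound⇒weighted-log-concave {ι (suc j)} {ι n - ι (suc j)}
    (0<ι[1+n] j) (0≤p⇒0<p+1 (p≤q⇒0≤q-p (ι-mono-≤ (ℕP.<⇒≤ j+1<n))))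
    (0≤levelSum n nonNegative j) (0≤levelSum n nonNegative (suc (suc j)))
    (nonNegMonotoneSubmodular⇒averaged-bound isF j)
  where open IsNonNegMonotoneSubmodular isF

mainTheorem3 : (n : ℕ) (f : Subset n → ℚ) →
    IsCoverage f ⊎ IsSumOfMatroidRanks f →
    UltraLogConcave n (levelSum n f)
mainTheorem3 n f hyp =
  weightedLogConcave⇒ultraLogConcave {c = levelSum n f}
    (nonNegMonotoneSubmodular⇒weightedLogConcave
      ([ coverage⇒nonNegMonotoneSubmodular , sumOfMatroidRanks⇒nonNegMonotoneSubmodular ]′ hyp))
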